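{- Let $G\supseteq \mathrm{Aut}(\Delta)$ be a closed permutation group on $D$, let $c_1,\ldots,c_n\in D$, and let $f\colon(\Delta,c_1,\ldots,c_n)\rightarrow\Delta$ be an order preserving canonical function generated by $G$. Assume that there exists $1\leq i\leq n$ such that $f$ keeps the graph relation on $D\setminus\{c_1,\ldots,c_n\}$, and such that $f$ flips the graph relation between $\{c_i\}$ and $D\setminus\{c_1,\ldots,c_n\}$. Then $G$ contains the order preserving switch, i.e., for every finite $A\subseteq D$ and every $S\subseteq A$ there exists $\alpha\in G$ whose restriction to $A$ preserves $<$ and such that for all distinct $a,b\in A$: if exactly one of $a,b$ lies in $S$ then $E(a,b)\Leftrightarrow \neg E(\alpha(a),\alpha(b))$, and otherwise $E(a,b)\Leftrightarrow E(\alpha(a),\alpha(b))$.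
   Context: $\Delta=(D;<,E)$ denotes the random ordered graph: the Fraïssé limit of the class of all finite simple undirected graphs equipped with a linear order; $D$ is countable, $<$ a dense linear order without endpoints, $E$ the edge relation. A permutation group on $D$ is closed if it is closed in the topology of pointwise convergence. For $c_1,\ldots,c_n\in D$, $\mathrm{Aut}(\Delta,c_1,\ldots,c_n)$ is the stabilizer of $c_1,\ldots,c_n$ in $\mathrm{Aut}(\Delta)$. A function $f\colon D\to D$ is canonical $(\Delta,c_1,\ldots,c_n)\rightarrow\Delta$ if for all $k\ge1$ and all $k$-tuples $a,b$ in the same orbit of $\mathrm{Aut}(\Delta,c_1,\ldots,c_n)$ (componentwise action), $f(a)$ and $f(b)$ lie in the same orbit of $\mathrm{Aut}(\Delta)$; it is order preserving if $x<y$ implies $f(x)<f(y)$. For $P,Q\subseteq D$, $f$ keeps the graph relation between $P$ and $Q$ if for all distinct $p\in P,q\in Q$: $E(p,q)\Leftrightarrow E(f(p),f(q))$; it flips it if $E(p,q)\Leftrightarrow\neg E(f(p),f(q))$; "on $P$" means "between $P$ and $P$". $f$ is generated by a closed group $G$ if for every finite $A\subseteq D$ some $g\in G$ agrees with $f$ on $A$. (In the paper, "G contains the order preserving switch" is expressed as "$G$ contains $\mathrm{mix}_{\mathrm{sw}}\,\mathrm{id}$"; for closed $G\supseteq\mathrm{Aut}(\Delta)$ this is the local property stated in the claim.) -}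

module Defs where

open import Data.Nat using (ℕ)
open import Data.Fin using (Fin)
open import Data.List using (List; _++_)
open import Data.List.Membership.Propositional using (_∈_; _∉_)
open import Data.Product using (Σ; ∃; _×_; _,_)
open import Data.Sum using (_⊎_)
open import Data.Empty using (⊥)
open import Relation.Nullary using (¬_; Dec)
open import Relation.Binary using (Rel; Decidable; Symmetric; Irreflexive; IsStrictTotalOrder)
open import Relation.Binary.PropositionalEquality using (_≡_; _≢_)
open import Function using (_∘_; _↔_; Inverse)
open import Function.Bundles using (_⇔_)

-- The random ordered graph Δ = (D; <, E), given axiomatically:
-- a countable linearly ordered simple graph with the extension property
-- of the Fraïssé limit of finite ordered graphs (these axioms determine
-- Δ up to isomorphism).

record RandomOrderedGraph : Set₁ where
  field
    D       : Set
    _<_     : Rel D _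
    E       : Rel D _
    <-sto   : IsStrictTotalOrder _≡_ _<_
    E-sym   : Symmetric E
    E-irr   : Irreflexive _≡_ E
    E?      : Decidable E
    enum    : ℕ → D
    enum-surj : ∀ (d : D) → ∃ λ m → enum m ≡ d
    extension : ∀ (L R U : List D) →
      (∀ {l r} → l ∈ L → r ∈ R → l < r) →
      (∀ {u} → u ∈ U → u ∈ L ++ R) →
      ∃ λ x → (∀ {l} → l ∈ L → l < x) × (∀ {r} → r ∈ R → x < r)
            × (∀ {u} → u ∈ U → E x u)
            × (∀ {a} → a ∈ L ++ R → a ∉ U → ¬ E x a)

module _ (Δ : RandomOrderedGraph) where
  open RandomOrderedGraph Δ

  Perm : Set
  Perm = D ↔ D

  app : Perm → D → D
  app = Inverse.to

  IsAut : Perm → Set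
  IsAut α = ∀ x y → ((x < y) ⇔ (app α x < app α y)) × (E x y ⇔ E (app α x) (app α y))

  IsAutC : ∀ {n} → (Fin n → D) → Perm → Set
  IsAutC c α = IsAut α × (∀ j → app α (c j) ≡ c j)

  record IsClosedPermGroup (G : Perm → Set) : Set₁ where
    field
      has-id  : ∀ (α : Perm) → (∀ x → app α x ≡ x) → G α
      closed-∘ : ∀ α β (γ : Perm) → G α → G β → (∀ x → app γ x ≡ app α (app β x)) → G γ
      closed-⁻¹ : ∀ α (γ : Perm) → G α → (∀ x → app γ x ≡ Inverse.from α x) → G γ
      -- closed in the topology of pointwise convergence
      topo-closed : ∀ (h : Perm) →
        (∀ (A : List D) → ∃ λ g → G g × (∀ {a} → a ∈ A → app g a ≡ app h a)) → G h

  Contains-Aut : (Perm → Set) → Set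
  Contains-Aut G = ∀ α → IsAut α → G α

  SameOrbit : (Perm → Set) → ∀ {k} → (Fin k → D) → (Fin k → D) → Set
  SameOrbit H a b = ∃ λ α → H α × (∀ j → app α (a j) ≡ b j)

  IsCanonical : ∀ {n} → (Fin n → D) → (D → D) → Set
  IsCanonical c f = ∀ (k : ℕ) (a b : Fin k → D) →
    SameOrbit (IsAutC c) a b → SameOrbit IsAut (f ∘ a) (f ∘ b)

  OrderPreserving : (D → D) → Set
  OrderPreserving f = ∀ {x y} → x < y → f x < f y

  GeneratedBy : (Perm → Set) → (D → D) → Set
  GeneratedBy G f = ∀ (A : List D) → ∃ λ g → G g × (∀ {a} → a ∈ A → app g a ≡ f a)

  NotConst : ∀ {n} → (Fin n → D) → D → Set
  NotConst c x = ∀ j → c j ≢ x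

  KeepsOnRest : ∀ {n} → (Fin n → D) → (D → D) → Set
  KeepsOnRest c f = ∀ p q → NotConst c p → NotConst c q → p ≢ q →
    (E p q ⇔ E (f p) (f q))

  FlipsBetween : ∀ {n} → (Fin n → D) → Fin n → (D → D) → Set
  FlipsBetween c i f = ∀ q → NotConst c q → c i ≢ q →
    (E (c i) q ⇔ (¬ E (f (c i)) (f q)))

  ContainsOPSwitch : (Perm → Set) → Set
  ContainsOPSwitch G = ∀ (A S : List D) → (∀ {s} → s ∈ S → s ∈ A) →
    ∃ λ α → G α
      × (∀ {a b} → a ∈ A → b ∈ A → a < b → app α a < app α b)
      × (∀ {a b} → a ∈ A → b ∈ A → a ≢ b →
           (((a ∈ S × b ∉ S) ⊎ (a ∉ S × b ∈ S)) → (E a b ⇔ (¬ E (app α a) (app α b))))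
         × (((a ∈ S × b ∈ S) ⊎ (a ∉ S × b ∉ S)) → (E a b ⇔ E (app α a) (app α b))))

module Submission where

-- Fix a finite set B and a vertex s.  By homogeneity of Δ there is an
-- automorphism β with β s = cᵢ which moves every other vertex of B off the
-- constants; some g ∈ G agrees with f on β[B].  Then g ∘ β ∈ G is order
-- preserving on B, flips the edges at s and keeps all other edges of B: it
-- switches B at the single vertex s.  Composing one such switch for each
-- element of S switches A at S.

open import Defs
open import Algebra.Bundles using (CommutativeRing)
open import Data.Bool using (Bool; true; false; _xor_)
open import Data.Bool.Properties using (xor-assoc; xor-identityʳ; xor-∧-commutativeRing)
open import Data.Empty using (⊥-elim)
open import Data.Fin using (Fin)
open import Data.List using (List; []; _∷_; [_]; _++_; map; filter; tabulate)
open import Data.List.Membership.Propositional using (_∈_; _∉_)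
open import Data.List.Membership.Propositional.Properties
  using (∈-map⁺; ∈-map⁻; ∈-filter⁺; ∈-filter⁻; ∈-++⁺ˡ; ∈-++⁺ʳ; ∈-++⁻; ∈-tabulate⁺)
open import Data.List.Relation.Binary.Subset.Propositional using (_⊆_)
open import Data.List.Relation.Unary.Any using (here; there)
import Data.List.Relation.Unary.All as All
open import Data.Nat using (ℕ; zero; suc; _⊔_; _≤′_; ≤′-refl; ≤′-step)
open import Data.Nat.Properties using (≤⇒≤′; m≤m⊔n; m≤n⊔m)
open import Data.Product using (_×_; ∃; Σ; _,_; proj₁; proj₂; swap)
open import Data.Sum using (_⊎_; inj₁; inj₂)
open import Function using (_∘_; id; _⇔_)
open import Function.Bundles using (mk⇔; mk↔ₛ′; Equivalence; Injection)
open import Function.Properties.Inverse using (↔-refl; ↔-trans; ↔⇒↣)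
open import Relation.Binary using (tri<; tri≈; tri>; IsStrictTotalOrder)
open import Relation.Binary.PropositionalEquality
  using (_≡_; _≢_; refl; sym; trans; cong; cong₂; subst; subst₂; module ≡-Reasoning)
open import Relation.Nullary using (¬_; Dec; yes; no; does)
open import Relation.Nullary.Decidable using (dec-true; dec-false)
open import Relation.Unary using (Decidable)

open Equivalence using () renaming (to to ⇒; from to ⇐)
open import Algebra.Properties.CommutativeSemigroup
  (CommutativeRing.+-commutativeSemigroup xor-∧-commutativeRing)
  using () renaming (interchange to xor-interchange)

does-⇔ : {P Q : Set} (p : Dec P) (q : Dec Q) → P ⇔ Q → does p ≡ does q
does-⇔ (yes _) (yes _) _   = refl
does-⇔ (yes a) (no ¬b) a⇔b = ⊥-elim (¬b (⇒ a⇔b a))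
does-⇔ (no ¬a) (yes b) a⇔b = ⊥-elim (¬a (⇐ a⇔b b))
does-⇔ (no _)  (no _)  _   = refl

-- P and Q are equivalent (parity false) or P is equivalent to ¬ Q (parity true);
-- the two ways in which a switch relates an edge to its image.
Parity : Bool → Set → Set → Set
Parity false P Q = P ⇔ Q
Parity true  P Q = P ⇔ (¬ Q)

does-parity : {P Q : Set} (p : Dec P) (q : Dec Q) (b : Bool) →
              Parity b P Q → does q ≡ does p xor b
does-parity (yes _) (yes _) false _   = refl
does-parity (yes a) (no ¬b) false a⇔b = ⊥-elim (¬b (⇒ a⇔b a))
does-parity (no ¬a) (yes b) false a⇔b = ⊥-elim (¬a (⇐ a⇔b b))
does-parity (no _)  (no _)  false _   = refl
does-parity (yes a) (yes b) true  a⇔¬b = ⊥-elim (⇒ a⇔¬b a b)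
does-parity (yes _) (no _)  true  _    = refl
does-parity (no _)  (yes _) true  _    = refl
does-parity (no ¬a) (no ¬b) true  a⇔¬b = ⊥-elim (¬a (⇐ a⇔¬b ¬b))

parity-does : {P Q : Set} (p : Dec P) (q : Dec Q) (b : Bool) →
              does q ≡ does p xor b → Parity b P Q
parity-does (yes a) (yes b) false _ = mk⇔ (λ _ → b) (λ _ → a)
parity-does (yes _) (no _)  false ()
parity-does (no _)  (yes _) false ()
parity-does (no ¬a) (no ¬b) false _ = mk⇔ (⊥-elim ∘ ¬a) (⊥-elim ∘ ¬b)
parity-does (yes _) (yes _) true  ()
parity-does (yes a) (no ¬b) true  _ = mk⇔ (λ _ → ¬b) (λ _ → a)
parity-does (no ¬a) (yes b) true  _ = mk⇔ (⊥-elim ∘ ¬a) (λ ¬b → ⊥-elim (¬b b))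
parity-does (no _)  (no _)  true  ()

module _ (Δ : RandomOrderedGraph) where
  open RandomOrderedGraph Δ
  open IsStrictTotalOrder <-sto using (compare; _≟_; _<?_; irrefl; asym)
    renaming (trans to <-trans)
  open import Data.List.Membership.DecPropositional _≟_ using (_∈?_)

  edge : D → D → Bool
  edge a b = does (E? a b)

  edge-sym : ∀ a b → edge a b ≡ edge b a
  edge-sym a b = does-⇔ (E? a b) (E? b a) (mk⇔ E-sym E-sym)

  edge-cong : ∀ {a b a' b'} → E a b ⇔ E a' b' → edge a b ≡ edge a' b'
  edge-cong = does-⇔ (E? _ _) (E? _ _)

  -- A finite partial map D ⇀ D is given by the list of its pairs (x , y).
  Pair : Set
  Pair = D × D

  Preserves : Pair → Pair → Set
  Preserves (x , y) (x' , y') = ((x < x') ⇔ (y < y')) × (E x x' ⇔ E y y')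

  preserves-refl : ∀ p → Preserves p p
  preserves-refl _ = mk⇔ (⊥-elim ∘ irrefl refl) (⊥-elim ∘ irrefl refl)
                   , mk⇔ (⊥-elim ∘ E-irr refl) (⊥-elim ∘ E-irr refl)

  PartialIso : List Pair → Set
  PartialIso P = ∀ {p q} → p ∈ P → q ∈ P → Preserves p q

  singleton-iso : ∀ p → PartialIso [ p ]
  singleton-iso p (here refl) (here refl) = preserves-refl p

  swap-iso : ∀ {P} → PartialIso P → PartialIso (map swap P)
  swap-iso iso p∈ q∈ with ∈-map⁻ swap p∈ | ∈-map⁻ swap q∈
  ... | _ , p∈P , refl | _ , q∈P , refl with iso p∈P q∈P
  ...   | o , e = mk⇔ (⇐ o) (⇒ o) , mk⇔ (⇐ e) (⇒ e)

  -- A family of pairwise preserving pairs is the graph of an injective function: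
  -- the order is strict and total, so equal points have equal partners.
  module _ {R : Pair → Set} (pres : ∀ {p q} → R p → R q → Preserves p q) where
    functional : ∀ {x y y'} → R (x , y) → R (x , y') → y ≡ y'
    functional {y = y} {y'} r r' with compare y y'
    ... | tri< y<y' _ _ = ⊥-elim (irrefl refl (⇐ (proj₁ (pres r r')) y<y'))
    ... | tri≈ _ y≡y' _ = y≡y'
    ... | tri> _ _ y'<y = ⊥-elim (irrefl refl (⇐ (proj₁ (pres r' r)) y'<y))

    injective : ∀ {x x' y} → R (x , y) → R (x' , y) → x ≡ x'
    injective {x = x} {x'} r r' with compare x x'
    ... | tri< x<x' _ _ = ⊥-elim (irrefl refl (⇒ (proj₁ (pres r r')) x<x'))
    ... | tri≈ _ x≡x' _ = x≡x'
    ... | tri> _ _ x'<x = ⊥-elim (irrefl refl (⇒ (proj₁ (pres r' r)) x'<x))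

  reflects-< : ∀ {a b c d} → a ≢ b → (a < b → c < d) → (b < a → d < c) →
               ((a < b) ⇔ (c < d)) × ((b < a) ⇔ (d < c))
  reflects-< {a} {b} a≢b ab⇒cd ba⇒dc = mk⇔ ab⇒cd back , mk⇔ ba⇒dc forth
    where
    back : _ → a < b
    back c<d with compare a b
    ... | tri< a<b _ _ = a<b
    ... | tri≈ _ a≡b _ = ⊥-elim (a≢b a≡b)
    ... | tri> _ _ b<a = ⊥-elim (asym c<d (ba⇒dc b<a))
    forth : _ → b < a
    forth d<c with compare a b
    ... | tri< a<b _ _ = ⊥-elim (asym d<c (ab⇒cd a<b))
    ... | tri≈ _ a≡b _ = ⊥-elim (a≢b a≡b)
    ... | tri> _ _ b<a = b<a

  Realizes : List D → List D → List D → D → Set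
  Realizes L R U x = (∀ {l} → l ∈ L → l < x) × (∀ {r} → r ∈ R → x < r)
                   × (∀ {u} → u ∈ U → E x u) × (∀ {a} → a ∈ L ++ R → a ∉ U → ¬ E x a)

  -- The extension property, with the realizing vertex outside a given finite
  -- set K: adding to R the elements of K above all of L excludes K.
  extension-avoiding : (L R U K : List D) → (∀ {l r} → l ∈ L → r ∈ R → l < r) →
                       U ⊆ L ++ R → ∃ λ x → Realizes L R U x × x ∉ K
  extension-avoiding L R U K L<R U⊆ = restrict (extension L R' U L<R' (widen ∘ U⊆))
    where
    aboveL? : Decidable (λ k → All.All (_< k) L)
    aboveL? k = All.all? (_<? k) L
    R' : List D
    R' = R ++ filter aboveL? K
    widen : L ++ R ⊆ L ++ R'
    widen a∈ with ∈-++⁻ L a∈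
    ... | inj₁ a∈L = ∈-++⁺ˡ a∈L
    ... | inj₂ a∈R = ∈-++⁺ʳ L (∈-++⁺ˡ a∈R)
    L<R' : ∀ {l r} → l ∈ L → r ∈ R' → l < r
    L<R' l∈ r∈ with ∈-++⁻ R r∈
    ... | inj₁ r∈R = L<R l∈ r∈R
    ... | inj₂ r∈K = All.lookup (proj₂ (∈-filter⁻ aboveL? {xs = K} r∈K)) l∈
    restrict : ∃ (Realizes L R' U) → ∃ λ x → Realizes L R U x × x ∉ K
    restrict (x , below , above , adj , nonadj) =
      x , (below , (above ∘ ∈-++⁺ˡ) , adj , (λ a∈ → nonadj (widen a∈)))
        , λ x∈K → irrefl refl (above (∈-++⁺ʳ R (∈-filter⁺ aboveL? x∈K (All.tabulate below))))

  imagesWhere : {Q : Pair → Set} → Decidable Q → List Pair → List D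
  imagesWhere Q? P = map proj₂ (filter Q? P)

  images⁺ : ∀ {Q : Pair → Set} (Q? : Decidable Q) {P p} → p ∈ P → Q p → proj₂ p ∈ imagesWhere Q? P
  images⁺ Q? p∈ q = ∈-map⁺ proj₂ (∈-filter⁺ Q? p∈ q)

  images⁻ : ∀ {Q : Pair → Set} (Q? : Decidable Q) {P y} → y ∈ imagesWhere Q? P →
            ∃ λ p → p ∈ P × Q p × y ≡ proj₂ p
  images⁻ Q? {P} y∈ with ∈-map⁻ proj₂ y∈
  ... | p , p∈ , refl = p , proj₁ (∈-filter⁻ Q? {xs = P} p∈) , proj₂ (∈-filter⁻ Q? {xs = P} p∈) , refl

  -- The image is found by
  -- the extension property, realizing over the range the type of x over the domain.
  forth : (P : List Pair) → PartialIso P → (x : D) → x ∉ map proj₁ P → (K : List D) →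
          ∃ λ y → PartialIso ((x , y) ∷ P) × y ∉ K
  forth P iso x x∉dom K = extend (extension-avoiding L R U K L<R U⊆L++R)
    where
    L R U : List D
    L = imagesWhere (λ p → proj₁ p <? x) P
    R = imagesWhere (λ p → x <? proj₁ p) P
    U = imagesWhere (λ p → E? x (proj₁ p)) P

    off-x : ∀ {p} → p ∈ P → proj₁ p ≢ x
    off-x p∈ refl = x∉dom (∈-map⁺ proj₁ p∈)

    L<R : ∀ {l r} → l ∈ L → r ∈ R → l < r
    L<R l∈ r∈ with images⁻ _ l∈ | images⁻ _ r∈
    ... | p , p∈ , p<x , refl | q , q∈ , x<q , refl = ⇒ (proj₁ (iso p∈ q∈)) (<-trans p<x x<q)

    in-L++R : ∀ {p} → p ∈ P → proj₂ p ∈ L ++ R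
    in-L++R {p} p∈ with compare (proj₁ p) x
    ... | tri< p<x _ _ = ∈-++⁺ˡ (images⁺ _ p∈ p<x)
    ... | tri≈ _ p≡x _ = ⊥-elim (off-x p∈ p≡x)
    ... | tri> _ _ x<p = ∈-++⁺ʳ L (images⁺ _ p∈ x<p)

    U⊆L++R : U ⊆ L ++ R
    U⊆L++R u∈ with images⁻ _ u∈
    ... | p , p∈ , _ , refl = in-L++R p∈

    extend : (∃ λ y → Realizes L R U y × y ∉ K) → ∃ λ y → PartialIso ((x , y) ∷ P) × y ∉ K
    extend (y , (below , above , adj , nonadj) , y∉K) = y , iso' , y∉K
      where
      ordered : ∀ {q} → q ∈ P → ((x < proj₁ q) ⇔ (y < proj₂ q)) × ((proj₁ q < x) ⇔ (proj₂ q < y))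
      ordered q∈ = reflects-< (λ x≡q → off-x q∈ (sym x≡q))
                             (λ x<q → above (images⁺ _ q∈ x<q)) (λ q<x → below (images⁺ _ q∈ q<x))

      -- x ~ q₁ iff y ~ q₂: the neighbours of y among L ++ R are exactly U,
      -- and U contains q₂ only via q itself since P is injective.
      adjacent : ∀ {q} → q ∈ P → E x (proj₁ q) ⇔ E y (proj₂ q)
      adjacent {q₁ , q₂} q∈ = mk⇔ (λ e → adj (images⁺ _ q∈ e)) back
        where
        not-in-U : ¬ E x q₁ → q₂ ∉ U
        not-in-U ¬e u∈ with images⁻ _ u∈
        ... | p , p∈ , e , refl = ¬e (subst (E x) (injective {R = _∈ P} iso p∈ q∈) e)
        back : E y q₂ → E x q₁
        back e with E? x q₁
        ... | yes e' = e'
        ... | no ¬e' = ⊥-elim (nonadj (in-L++R q∈) (not-in-U ¬e') e)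

      iso' : PartialIso ((x , y) ∷ P)
      iso' (here refl) (here refl) = preserves-refl (x , y)
      iso' (here refl) (there q∈) = proj₁ (ordered q∈) , adjacent q∈
      iso' (there p∈) (here refl) =
        proj₂ (ordered p∈) , mk⇔ (E-sym ∘ ⇒ (adjacent p∈) ∘ E-sym) (E-sym ∘ ⇐ (adjacent p∈) ∘ E-sym)
      iso' (there p∈) (there q∈) = iso p∈ q∈

  extendDomain : (P : List Pair) → PartialIso P → (x : D) (K : List D) →
    ∃ λ Q → PartialIso Q × P ⊆ Q × (∃ λ y → (x , y) ∈ Q) × (∀ {q} → q ∈ Q → q ∈ P ⊎ proj₂ q ∉ K)
  extendDomain P iso x K with x ∈? map proj₁ P
  ... | yes x∈dom with ∈-map⁻ proj₁ x∈dom
  ...   | (_ , y) , xy∈ , refl = P , iso , id , (y , xy∈) , inj₁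
  extendDomain P iso x K | no x∉dom with forth P iso x x∉dom K
  ... | y , iso' , y∉K = (x , y) ∷ P , iso' , there , (y , here refl) , new
    where
    new : ∀ {q} → q ∈ (x , y) ∷ P → q ∈ P ⊎ proj₂ q ∉ K
    new (here refl) = inj₂ y∉K
    new (there q∈) = inj₁ q∈

  extendRange : (P : List Pair) → PartialIso P → (y : D) →
    ∃ λ Q → PartialIso Q × P ⊆ Q × (∃ λ x → (x , y) ∈ Q)
  extendRange P iso y with extendDomain (map swap P) (swap-iso iso) y []
  ... | Q , isoQ , P⊆Q , (x , yx∈) , _ =
    map swap Q , swap-iso isoQ , (λ p∈ → ∈-map⁺ swap (P⊆Q (∈-map⁺ swap p∈))) , (x , ∈-map⁺ swap yx∈)

  Stage : Set
  Stage = Σ (List Pair) PartialIso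

  round : (S : Stage) (x : D) → Σ Stage λ S' → proj₁ S ⊆ proj₁ S'
          × (∃ λ y → (x , y) ∈ proj₁ S') × (∃ λ z → (z , x) ∈ proj₁ S')
  round (P , iso) x with extendDomain P iso x []
  ... | Q , isoQ , P⊆Q , (y , xy∈) , _ with extendRange Q isoQ x
  ...   | R , isoR , Q⊆R , (z , zx∈) = (R , isoR) , Q⊆R ∘ P⊆Q , (y , Q⊆R xy∈) , (z , zx∈)

  -- Round k handles the k-th vertex of the enumeration; the
  -- union of the increasing chain of stages is the graph of the automorphism.
  module BackAndForth (P : List Pair) (iso : PartialIso P) where
    stage : ℕ → Stage
    stage zero = P , iso
    stage (suc k) = proj₁ (round (stage k) (enum k))

    graph : ℕ → List Pair
    graph k = proj₁ (stage k)

    -- Stages only grow, so any two of them lie in a common one.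
    increasing : ∀ {k l} → k ≤′ l → graph k ⊆ graph l
    increasing ≤′-refl = id
    increasing (≤′-step {l} k≤l) = proj₁ (proj₂ (round (stage l) (enum l))) ∘ increasing k≤l

    InLimit : Pair → Set
    InLimit p = ∃ λ k → p ∈ graph k

    limit-preserves : ∀ {p q} → InLimit p → InLimit q → Preserves p q
    limit-preserves (k , p∈) (l , q∈) =
      proj₂ (stage (k ⊔ l)) (increasing (≤⇒≤′ (m≤m⊔n k l)) p∈) (increasing (≤⇒≤′ (m≤n⊔m k l)) q∈)

    -- Vertex number k enters domain and range in round k.
    total : ∀ x → ∃ λ y → InLimit (x , y)
    total x with enum-surj x
    ... | k , refl = let (_ , _ , (y , xy∈) , _) = round (stage k) (enum k) in y , suc k , xy∈

    onto : ∀ y → ∃ λ x → InLimit (x , y)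
    onto y with enum-surj y
    ... | k , refl = let (_ , _ , _ , (x , xy∈)) = round (stage k) (enum k) in x , suc k , xy∈

    β : D → D
    β x = proj₁ (total x)

    β⁻¹ : D → D
    β⁻¹ y = proj₁ (onto y)

    automorphism : Perm Δ
    automorphism = mk↔ₛ′ β β⁻¹
      (λ y → functional limit-preserves (proj₂ (total (β⁻¹ y))) (proj₂ (onto y)))
      (λ x → injective limit-preserves (proj₂ (onto (β x))) (proj₂ (total x)))

    is-aut : IsAut Δ automorphism
    is-aut x y = limit-preserves (proj₂ (total x)) (proj₂ (total y))

    extends : ∀ {x y} → (x , y) ∈ P → app Δ automorphism x ≡ y
    extends xy∈ = functional limit-preserves (proj₂ (total _)) (0 , xy∈)

  homogeneous : (P : List Pair) → PartialIso P →
                ∃ λ β → IsAut Δ β × (∀ {x y} → (x , y) ∈ P → app Δ β x ≡ y)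
  homogeneous P iso = automorphism , is-aut , extends
    where open BackAndForth P iso

  coverAvoiding : (s t : D) (K B : List D) →
    ∃ λ P → PartialIso P × (s , t) ∈ P × (∀ {b} → b ∈ B → ∃ λ y → (b , y) ∈ P)
          × (∀ {p} → p ∈ P → p ≡ (s , t) ⊎ proj₂ p ∉ K)
  coverAvoiding s t K [] = [ s , t ] , singleton-iso (s , t) , here refl , (λ ()) , λ { (here refl) → inj₁ refl }
  coverAvoiding s t K (b ∷ B) with coverAvoiding s t K B
  ... | P , iso , st∈ , covers , avoids with extendDomain P iso b K
  ...   | Q , isoQ , P⊆Q , (y , by∈) , new = Q , isoQ , P⊆Q st∈ , covers' , avoids'
    where
    covers' : ∀ {b'} → b' ∈ b ∷ B → ∃ λ y' → (b' , y') ∈ Q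
    covers' (here refl) = y , by∈
    covers' (there b'∈) = proj₁ (covers b'∈) , P⊆Q (proj₂ (covers b'∈))
    avoids' : ∀ {q} → q ∈ Q → q ≡ (s , t) ⊎ proj₂ q ∉ K
    avoids' q∈ with new q∈
    ... | inj₁ q∈P = avoids q∈P
    ... | inj₂ q∉K = inj₂ q∉K

  sendAvoiding : (s t : D) (K B : List D) →
    ∃ λ β → IsAut Δ β × app Δ β s ≡ t × (∀ {b} → b ∈ B → b ≢ s → app Δ β b ∉ K)
  sendAvoiding s t K B with coverAvoiding s t K B
  ... | P , iso , st∈ , covers , avoids with homogeneous P iso
  ...   | β , aut , extends = β , aut , extends st∈ , off-K
    where
    off-K : ∀ {b} → b ∈ B → b ≢ s → app Δ β b ∉ K
    off-K b∈ b≢s with covers b∈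
    ... | y , by∈ with avoids by∈
    ...   | inj₁ by≡st = ⊥-elim (b≢s (cong proj₁ by≡st))
    ...   | inj₂ y∉K = subst (_∉ K) (sym (extends by∈)) y∉K

  injective-app : (α : Perm Δ) → ∀ {a b} → app Δ α a ≡ app Δ α b → a ≡ b
  injective-app α = Injection.injective (↔⇒↣ α)

  record Switches (A : List D) (χ : D → Bool) (α : Perm Δ) : Set where
    field
      monotone  : ∀ {a b} → a ∈ A → b ∈ A → a < b → app Δ α a < app Δ α b
      switching : ∀ {a b} → a ∈ A → b ∈ A → a ≢ b →
                  edge (app Δ α a) (app Δ α b) ≡ edge a b xor (χ a xor χ b)
  open Switches

  identity-switches : ∀ A → Switches A (λ _ → false) ↔-refl
  identity-switches A = record
    { monotone  = λ _ _ a<b → a<b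
    ; switching = λ _ _ _ → sym (xor-identityʳ _)
    }

  switches-∘ : ∀ {A χ ψ α σ} → Switches A χ α → Switches (map (app Δ α) A) ψ σ →
               Switches A (λ x → χ x xor ψ (app Δ α x)) (↔-trans α σ)
  switches-∘ {A} {χ} {ψ} {α} {σ} swα swσ = record { monotone = mono ; switching = switch }
    where
    α· σ· : D → D
    α· = app Δ α
    σ· = app Δ σ
    mapped : ∀ {a} → a ∈ A → α· a ∈ map α· A
    mapped = ∈-map⁺ α·
    mono : ∀ {a b} → a ∈ A → b ∈ A → a < b → σ· (α· a) < σ· (α· b)
    mono a∈ b∈ a<b = monotone swσ (mapped a∈) (mapped b∈) (monotone swα a∈ b∈ a<b)
    switch : ∀ {a b} → a ∈ A → b ∈ A → a ≢ b → edge (σ· (α· a)) (σ· (α· b))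
             ≡ edge a b xor ((χ a xor ψ (α· a)) xor (χ b xor ψ (α· b)))
    switch {a} {b} a∈ b∈ a≢b = begin
      edge (σ· (α· a)) (σ· (α· b))
        ≡⟨ switching swσ (mapped a∈) (mapped b∈) (a≢b ∘ injective-app α) ⟩
      edge (α· a) (α· b) xor (ψ (α· a) xor ψ (α· b))
        ≡⟨ cong (_xor (ψ (α· a) xor ψ (α· b))) (switching swα a∈ b∈ a≢b) ⟩
      (edge a b xor (χ a xor χ b)) xor (ψ (α· a) xor ψ (α· b))
        ≡⟨ xor-assoc (edge a b) _ _ ⟩
      edge a b xor ((χ a xor χ b) xor (ψ (α· a) xor ψ (α· b)))
        ≡⟨ cong (edge a b xor_) (xor-interchange (χ a) (χ b) _ _) ⟩
      edge a b xor ((χ a xor ψ (α· a)) xor (χ b xor ψ (α· b))) ∎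
      where open ≡-Reasoning

  switches-cong : ∀ {A χ χ' α} → (∀ {a} → a ∈ A → χ a ≡ χ' a) → Switches A χ α → Switches A χ' α
  switches-cong χ≗χ' sw = record
    { monotone  = monotone sw
    ; switching = λ {a} {b} a∈ b∈ a≢b →
        trans (switching sw a∈ b∈ a≢b) (cong₂ (λ u v → edge a b xor (u xor v)) (χ≗χ' a∈) (χ≗χ' b∈))
    }

  atPoint : D → D → Bool
  atPoint s x = does (x ≟ s)

  inside : List D → D → Bool
  inside S x = does (x ∈? S)

  inside-cons-∈ : ∀ {s S} → s ∈ S → ∀ x → inside (s ∷ S) x ≡ inside S x
  inside-cons-∈ {s} {S} s∈S x with x ≟ s
  ... | yes refl = sym (dec-true (x ∈? S) s∈S)
  ... | no _ = refl

  inside-cons-∉ : ∀ {s S} → s ∉ S → ∀ x → inside (s ∷ S) x ≡ inside S x xor atPoint s x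
  inside-cons-∉ {s} {S} s∉S x with x ≟ s
  ... | yes refl = cong (_xor true) (sym (dec-false (x ∈? S) s∉S))
  ... | no _ = sym (xor-identityʳ _)

  inside-odd : ∀ {S a b} → (a ∈ S × b ∉ S) ⊎ (a ∉ S × b ∈ S) → inside S a xor inside S b ≡ true
  inside-odd {S} {a} {b} (inj₁ (a∈ , b∉)) rewrite dec-true (a ∈? S) a∈ | dec-false (b ∈? S) b∉ = refl
  inside-odd {S} {a} {b} (inj₂ (a∉ , b∈)) rewrite dec-false (a ∈? S) a∉ | dec-true (b ∈? S) b∈ = refl

  inside-even : ∀ {S a b} → (a ∈ S × b ∈ S) ⊎ (a ∉ S × b ∉ S) → inside S a xor inside S b ≡ false
  inside-even {S} {a} {b} (inj₁ (a∈ , b∈)) rewrite dec-true (a ∈? S) a∈ | dec-true (b ∈? S) b∈ = refl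
  inside-even {S} {a} {b} (inj₂ (a∉ , b∉)) rewrite dec-false (a ∈? S) a∉ | dec-false (b ∈? S) b∉ = refl

  module _ (G : Perm Δ → Set) (closed : IsClosedPermGroup Δ G) (auts : Contains-Aut Δ G) where
    open IsClosedPermGroup closed using (has-id; closed-∘)

    PointSwitches : Set
    PointSwitches = ∀ B s → ∃ λ σ → G σ × Switches B (atPoint s) σ

    SetSwitches : Set
    SetSwitches = ∀ A S → ∃ λ α → G α × Switches A (inside S) α

    point⇒set : PointSwitches → SetSwitches
    point⇒set point A [] = ↔-refl , has-id ↔-refl (λ _ → refl) , identity-switches A
    point⇒set point A (s ∷ S) with s ∈? S | point⇒set point A S
    ... | yes s∈S | α , Gα , swα = α , Gα , switches-cong (λ {a} _ → sym (inside-cons-∈ s∈S a)) swα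
    ... | no s∉S | α , Gα , swα with point (map (app Δ α) A) (app Δ α s)
    ...   | σ , Gσ , swσ = ↔-trans α σ , closed-∘ σ α _ Gσ Gα (λ _ → refl)
                         , switches-cong (λ {a} _ → same-side a) (switches-∘ swα swσ)
      where
      same-side : ∀ a → inside S a xor atPoint (app Δ α s) (app Δ α a) ≡ inside (s ∷ S) a
      same-side a = trans
        (cong (inside S a xor_) (does-⇔ (app Δ α a ≟ app Δ α s) (a ≟ s) (mk⇔ (injective-app α) (cong (app Δ α)))))
        (sym (inside-cons-∉ s∉S a))

    set⇒OPSwitch : SetSwitches → ContainsOPSwitch Δ G
    set⇒OPSwitch switches A S _ with switches A S
    ... | α , Gα , sw = α , Gα , monotone sw , λ a∈ b∈ a≢b → across a∈ b∈ a≢b , within a∈ b∈ a≢b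
      where
      changes-by : ∀ {a b} (p : Bool) → a ∈ A → b ∈ A → a ≢ b → inside S a xor inside S b ≡ p →
                   Parity p (E a b) (E (app Δ α a) (app Δ α b))
      changes-by {a} {b} p a∈ b∈ a≢b parity = parity-does (E? a b) (E? _ _) p
        (trans (switching sw a∈ b∈ a≢b) (cong (edge a b xor_) parity))
      across : ∀ {a b} → a ∈ A → b ∈ A → a ≢ b → (a ∈ S × b ∉ S) ⊎ (a ∉ S × b ∈ S) →
               E a b ⇔ (¬ E (app Δ α a) (app Δ α b))
      across a∈ b∈ a≢b odd = changes-by true a∈ b∈ a≢b (inside-odd odd)
      within : ∀ {a b} → a ∈ A → b ∈ A → a ≢ b → (a ∈ S × b ∈ S) ⊎ (a ∉ S × b ∉ S) →
               E a b ⇔ E (app Δ α a) (app Δ α b)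
      within a∈ b∈ a≢b even = changes-by false a∈ b∈ a≢b (inside-even even)

    module FromCanonical {n} (c : Fin n → D) (f : D → D) (i : Fin n)
      (f-monotone : OrderPreserving Δ f) (generated : GeneratedBy Δ G f)
      (keeps : KeepsOnRest Δ c f) (flips : FlipsBetween Δ c i f) where

      composite-switches : ∀ {B s} (β g : Perm Δ) → IsAut Δ β → app Δ β s ≡ c i →
        (∀ {b} → b ∈ B → b ≢ s → app Δ β b ∉ tabulate c) →
        (∀ {b} → b ∈ B → app Δ g (app Δ β b) ≡ f (app Δ β b)) →
        Switches B (atPoint s) (↔-trans β g)
      composite-switches {B} {s} β g aut βs≡cᵢ avoids agrees =
        record { monotone = mono ; switching = switch }
        where
        β· σ· : D → D
        β· = app Δ β
        σ· = app Δ (↔-trans β g)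

        off-constants : ∀ {b} → b ∈ B → b ≢ s → NotConst Δ c (β· b)
        off-constants b∈ b≢s j cⱼ≡βb = avoids b∈ b≢s (subst (_∈ tabulate c) cⱼ≡βb (∈-tabulate⁺ j))

        mono : ∀ {a b} → a ∈ B → b ∈ B → a < b → σ· a < σ· b
        mono a∈ b∈ a<b = subst₂ _<_ (sym (agrees a∈)) (sym (agrees b∈)) (f-monotone (⇒ (proj₁ (aut _ _)) a<b))

        flipped : ∀ {b} → s ∈ B → b ∈ B → b ≢ s → edge (σ· s) (σ· b) ≡ edge s b xor true
        flipped {b} s∈ b∈ b≢s = begin
          edge (σ· s) (σ· b)               ≡⟨ cong₂ edge (trans (agrees s∈) (cong f βs≡cᵢ)) (agrees b∈) ⟩
          edge (f (c i)) (f (β· b))        ≡⟨ does-parity (E? _ _) (E? _ _) true (flips (β· b) nc (nc i)) ⟩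
          edge (c i) (β· b) xor true       ≡⟨ cong (λ z → edge z (β· b) xor true) (sym βs≡cᵢ) ⟩
          edge (β· s) (β· b) xor true      ≡⟨ cong (_xor true) (sym (edge-cong (proj₂ (aut s b)))) ⟩
          edge s b xor true                ∎
          where
          open ≡-Reasoning
          nc = off-constants b∈ b≢s

        kept : ∀ {a b} → a ∈ B → b ∈ B → a ≢ b → a ≢ s → b ≢ s → edge (σ· a) (σ· b) ≡ edge a b xor false
        kept {a} {b} a∈ b∈ a≢b a≢s b≢s = begin
          edge (σ· a) (σ· b)          ≡⟨ cong₂ edge (agrees a∈) (agrees b∈) ⟩
          edge (f (β· a)) (f (β· b))  ≡⟨ sym (edge-cong (keeps _ _ (off-constants a∈ a≢s) (off-constants b∈ b≢s)
                                                               (a≢b ∘ injective-app β))) ⟩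
          edge (β· a) (β· b)          ≡⟨ sym (edge-cong (proj₂ (aut a b))) ⟩
          edge a b                    ≡⟨ sym (xor-identityʳ _) ⟩
          edge a b xor false          ∎
          where open ≡-Reasoning

        switch : ∀ {a b} → a ∈ B → b ∈ B → a ≢ b → edge (σ· a) (σ· b) ≡ edge a b xor (atPoint s a xor atPoint s b)
        switch {a} {b} a∈ b∈ a≢b with a ≟ s | b ≟ s
        ... | yes refl | yes refl = ⊥-elim (a≢b refl)
        ... | yes refl | no b≢s   = flipped a∈ b∈ b≢s
        ... | no a≢s   | yes refl =
          trans (edge-sym _ _) (trans (flipped b∈ a∈ a≢s) (cong (_xor true) (edge-sym b a)))
        ... | no a≢s   | no b≢s   = kept a∈ b∈ a≢b a≢s b≢s

      point-switches : PointSwitches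
      point-switches B s with sendAvoiding s (c i) (tabulate c) B
      ... | β , aut , βs≡cᵢ , avoids with generated (map (app Δ β) B)
      ...   | g , Gg , agrees = ↔-trans β g , closed-∘ g β _ Gg (auts β aut) (λ _ → refl)
                              , composite-switches β g aut βs≡cᵢ avoids (agrees ∘ ∈-map⁺ (app Δ β))

open RandomOrderedGraph using (D)

mainTheorem5 : (Δ : RandomOrderedGraph) (G : Perm Δ → Set) →
    IsClosedPermGroup Δ G → Contains-Aut Δ G →
    (n : ℕ) (c : Fin n → D Δ) (f : D Δ → D Δ) →
    IsCanonical Δ c f → OrderPreserving Δ f → GeneratedBy Δ G f →
    (∃ λ (i : Fin n) → KeepsOnRest Δ c f × FlipsBetween Δ c i f) →
    ContainsOPSwitch Δ G
mainTheorem5 Δ G closed auts _ c f _ f-monotone generated (i , keeps , flips) =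
  set⇒OPSwitch Δ G closed auts (point⇒set Δ G closed auts point-switches)
  where open FromCanonical Δ G closed auts c f i f-monotone generated keeps flips
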